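{- Let $s\ge 2$, $k \ge 0$ be two integers. Every locally $s$-colourable graph $G$ satisfies $f_G(\chi (G) + k) \le (s-1)(k+1) + 1$.
   Context: All graphs are finite, simple and non-empty. A graph $G$ is locally $s$-colourable if for every vertex $v$ the subgraph induced by the closed neighbourhood $N[v]$ has chromatic number at most $s$. For $\chi(G)\le p\le |V(G)|$, let $\mathscr{C}_p(G)$ be the set of proper colourings of $G$ using exactly $p$ colours, and define $f_G(p)=\max_{\sigma\in\mathscr{C}_p(G)}\min\{\chi(G[X]) : X\subseteq V(G),\ |\sigma(X)|=p\}$. -}

module Defs where

open import Data.Nat using (ℕ; suc; _≤_)
open import Data.Fin using (Fin)
open import Data.Product using (Σ; _×_; ∃)
open import Data.Sum using (_⊎_)
open import Relation.Binary.PropositionalEquality using (_≡_; _≢_)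
open import Relation.Nullary using (¬_)
open import Data.Unit using (⊤)

record Graph : Set₁ where
  field
    m    : ℕ
    Edge : Fin (suc m) → Fin (suc m) → Set
    sym  : ∀ {u v} → Edge u v → Edge v u
    irr  : ∀ {v} → ¬ Edge v v

  n : ℕ
  n = suc m

  V : Set
  V = Fin n

open Graph public

VSet : Graph → Set₁
VSet G = V G → Set

Full : (G : Graph) → VSet G
Full G _ = ⊤

Colourable : (G : Graph) → VSet G → ℕ → Set
Colourable G X c =
  Σ ((v : V G) → X v → Fin c) λ κ →
    ∀ u w (xu : X u) (xw : X w) → Edge G u w → κ u xu ≢ κ w xw

IsChromaticOn : (G : Graph) → VSet G → ℕ → Set
IsChromaticOn G X c = Colourable G X c × (∀ d → Colourable G X d → c ≤ d)

IsChromatic : Graph → ℕ → Set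
IsChromatic G c = IsChromaticOn G (Full G) c

ClosedNbhd : (G : Graph) → V G → VSet G
ClosedNbhd G v u = (u ≡ v) ⊎ Edge G v u

LocallyColourable : Graph → ℕ → Set
LocallyColourable G s = ∀ v → Colourable G (ClosedNbhd G v) s

Proper : (G : Graph) (p : ℕ) → (V G → Fin p) → Set
Proper G p σ = ∀ u w → Edge G u w → σ u ≢ σ w

Onto : (G : Graph) (p : ℕ) → (V G → Fin p) → Set
Onto G p σ = ∀ (c : Fin p) → ∃ λ v → σ v ≡ c

Cp : (G : Graph) (p : ℕ) → (V G → Fin p) → Set
Cp G p σ = Proper G p σ × Onto G p σ

SeesAll : (G : Graph) (p : ℕ) → (V G → Fin p) → VSet G → Set
SeesAll G p σ X = ∀ (c : Fin p) → ∃ λ v → X v × σ v ≡ c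

MinChi : (G : Graph) (p : ℕ) → (V G → Fin p) → ℕ → Set₁
MinChi G p σ r =
  (Σ (VSet G) λ X → SeesAll G p σ X × IsChromaticOn G X r)
  × (∀ (X : VSet G) d → SeesAll G p σ X → IsChromaticOn G X d → r ≤ d)

-- IsF G p v : v = f_G(p) = max over σ ∈ C_p(G) of MinChi G p σ.
IsF : Graph → ℕ → ℕ → Set₁
IsF G p v =
  (Σ (V G → Fin p) λ σ → Cp G p σ × MinChi G p σ v)
  × (∀ σ r → Cp G p σ → MinChi G p σ r → r ≤ v)

-- Fix σ ∈ C_p(G), p = χ(G) + k, and pick centres greedily: among the vertices whose colour is
-- still present, w maximises the number of present colours seen by its closed neighbourhood;
-- those colours S are discarded and the construction is repeated on the remaining classes.
-- The centres are independent and X = ⋃ N[wᵢ] sees every colour, so χ(G[X]) ≤ 1 + m (s - 1),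
-- each N(wᵢ) being (s - 1)-colourable. By maximality, a vertex of the colour of wᵢ that sees all
-- of Sᵢ has no neighbour in the remaining classes, which gives χ(before) ≤ χ(after) + |Sᵢ| - 1.
-- Hence χ(G) ≤ 1 + p - m, i.e. m ≤ k + 1.

module Submission where

open import Level using (0ℓ)
open import Data.Nat using (ℕ; zero; suc; _+_; _*_; _∸_; _≤_; _<_; _≤?_; z≤n; s≤s)
open import Data.Nat.Properties
  using (+-suc; +-comm; +-assoc; +-monoˡ-≤; +-monoʳ-≤; +-cancelʳ-≤; *-comm; *-monoˡ-≤;
         ≤-refl; ≤-trans; <⇒≱; ≮⇒≥; module ≤-Reasoning)
open import Data.Nat.Induction using (<-rec; <-wellFounded)
open import Data.Fin using (Fin; zero; suc; join; splitAt; combine; punchOut; inject≤)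
open import Data.Fin.Properties
  using (suc-injective; any?; _≟_; splitAt-join; combine-injective; punchOut-injective;
         inject≤-injective)
open import Data.Fin.Subset using (Subset; inside; outside; _∈_; _∉_; _⊆_; _⊂_; _─_; _-_; ⁅_⁆; ∣_∣; ⊤)
open import Data.Fin.Subset.Properties
  using (drop-∷-⊆; _∈?_; nonempty?; x∈p∧x∉q⇒x∈p─q; x∈p∧x≢y⇒x∈p-y; p─q⊆p; p⊂q⇒∣p∣<∣q∣;
         p∩q≢∅⇒∣p─q∣<∣p∣; x∈p∩q⁺; ∈⊤; ∣⊤∣≡n; ∣⁅x⁆∣≡1; x∈⁅y⁆⇒x≡y)
open import Data.Vec.Base using ([]; _∷_; here; there; tabulate)
open import Data.Vec.Properties using (lookup⇒[]=; []=⇒lookup; lookup∘tabulate)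
import Data.Vec.Functional as Vector
open import Data.List.Base using (filter; allFin)
open import Data.List.Extrema.Nat using (argmax; argmax-all; f[xs]≤f[argmax])
open import Data.List.Relation.Unary.All using (lookup)
open import Data.List.Relation.Unary.All.Properties using (all-filter)
open import Data.List.Membership.Propositional.Properties using (∈-filter⁺; ∈-allFin)
open import Data.Product using (∃; _×_; _,_; proj₁; proj₂)
open import Data.Sum using (_⊎_; inj₁; inj₂)
open import Data.Sum.Properties using (inj₁-injective; inj₂-injective)
open import Effect.Monad using (RawMonad)
open import Induction.WellFounded using (module All)
import Relation.Binary.Construct.On as On
open import Relation.Binary.PropositionalEquality
  using (_≡_; _≢_; refl; sym; trans; cong; subst; module ≡-Reasoning)
open import Relation.Nullary using (¬_; Dec; yes; no; does; contradiction)
open import Relation.Nullary.Decidable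
  using (_×-dec_; _⊎-dec_; ¬?; dec-true; decidable-stable; ¬¬-excluded-middle)
open import Relation.Nullary.Negation using (¬¬-Monad)
open import Relation.Unary as Pred using (Pred)

open import Defs hiding (sym)

∣p─q∣+∣q∣≡∣p∣ : ∀ {n} (p q : Subset n) → q ⊆ p → ∣ p ─ q ∣ + ∣ q ∣ ≡ ∣ p ∣
∣p─q∣+∣q∣≡∣p∣ []            []            _   = refl
∣p─q∣+∣q∣≡∣p∣ (inside  ∷ p) (inside  ∷ q) q⊆p =
  trans (+-suc _ _) (cong suc (∣p─q∣+∣q∣≡∣p∣ p q (drop-∷-⊆ q⊆p)))
∣p─q∣+∣q∣≡∣p∣ (outside ∷ p) (inside  ∷ q) q⊆p = contradiction (q⊆p here) λ ()
∣p─q∣+∣q∣≡∣p∣ (inside  ∷ p) (outside ∷ q) q⊆p = cong suc (∣p─q∣+∣q∣≡∣p∣ p q (drop-∷-⊆ q⊆p))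
∣p─q∣+∣q∣≡∣p∣ (outside ∷ p) (outside ∷ q) q⊆p = ∣p─q∣+∣q∣≡∣p∣ p q (drop-∷-⊆ q⊆p)

index : ∀ {n} (p : Subset n) {x} → x ∈ p → Fin ∣ p ∣
index (inside  ∷ p) here        = zero
index (inside  ∷ p) (there x∈p) = suc (index p x∈p)
index (outside ∷ p) (there x∈p) = index p x∈p

index-injective : ∀ {n} (p : Subset n) {x y} (x∈p : x ∈ p) (y∈p : y ∈ p) →
                  index p x∈p ≡ index p y∈p → x ≡ y
index-injective (inside  ∷ p) here        here        _  = refl
index-injective (inside  ∷ p) here        (there _)   ()
index-injective (inside  ∷ p) (there _)   here        ()
index-injective (inside  ∷ p) (there x∈p) (there y∈p) eq =
  cong suc (index-injective p x∈p y∈p (suc-injective eq))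
index-injective (outside ∷ p) (there x∈p) (there y∈p) eq = cong suc (index-injective p x∈p y∈p eq)

x∈p─q⇒x∉q : ∀ {n} {x : Fin n} {p q : Subset n} → x ∈ p ─ q → x ∉ q
x∈p─q⇒x∉q {p = _ ∷ _} {outside ∷ _} here        ()
x∈p─q⇒x∉q {p = _ ∷ _} {outside ∷ _} (there x∈)  (there x∈q) = x∈p─q⇒x∉q x∈ x∈q
x∈p─q⇒x∉q {p = _ ∷ _} {inside  ∷ _} (there x∈)  (there x∈q) = x∈p─q⇒x∉q x∈ x∈q

suc∣p-x∣≡∣p∣ : ∀ {n} {x : Fin n} {p : Subset n} → x ∈ p → suc ∣ p - x ∣ ≡ ∣ p ∣
suc∣p-x∣≡∣p∣ {x = x} {p} x∈p = begin
  suc ∣ p - x ∣          ≡⟨ +-comm 1 ∣ p - x ∣ ⟩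
  ∣ p - x ∣ + 1          ≡⟨ cong (∣ p - x ∣ +_) (∣⁅x⁆∣≡1 x) ⟨
  ∣ p - x ∣ + ∣ ⁅ x ⁆ ∣  ≡⟨ ∣p─q∣+∣q∣≡∣p∣ p ⁅ x ⁆ ⁅x⁆⊆p ⟩
  ∣ p ∣                  ∎
  where
  open ≡-Reasoning
  ⁅x⁆⊆p : ⁅ x ⁆ ⊆ p
  ⁅x⁆⊆p y∈⁅x⁆ = subst (_∈ p) (sym (x∈⁅y⁆⇒x≡y x y∈⁅x⁆)) x∈p

module _ {n} {P : Pred (Fin n) 0ℓ} (P? : Pred.Decidable P) where

  satisfying : Subset n
  satisfying = tabulate (λ x → does (P? x))

  ∈-satisfying⁺ : ∀ {x} → P x → x ∈ satisfying
  ∈-satisfying⁺ {x} px = lookup⇒[]= x _ (trans (lookup∘tabulate _ x) (dec-true (P? x) px))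

  ∈-satisfying⁻ : ∀ {x} → x ∈ satisfying → P x
  ∈-satisfying⁻ {x} x∈ with P? x | trans (sym (lookup∘tabulate _ x)) ([]=⇒lookup x∈)
  ... | yes px | _ = px
  ... | no _   | ()

module _ (G : Graph) where

  Independent : VSet G → Set
  Independent J = ∀ u v → J u → J v → ¬ Edge G u v

  colourable-⊆ : ∀ {X Y : VSet G} {c} → X Pred.⊆ Y → Colourable G Y c → Colourable G X c
  colourable-⊆ X⊆Y (κ , κ-proper) = (λ v x → κ v (X⊆Y x)) , λ u w xu xw → κ-proper u w (X⊆Y xu) (X⊆Y xw)

  independent-colourable : ∀ {J} → Independent J → Colourable G J 1
  independent-colourable J-indep = (λ _ _ → zero) , λ u w xu xw e _ → J-indep u w xu xw e

  colourable-∪ : ∀ {X Y : VSet G} {a b} → Colourable G X a → Colourable G Y b →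
                 Colourable G (X Pred.∪ Y) (a + b)
  colourable-∪ {X} {Y} {a} {b} (κ , κ-proper) (ρ , ρ-proper) = colour , colour-proper
    where
    side : ∀ v → (X Pred.∪ Y) v → Fin a ⊎ Fin b
    side v (inj₁ x) = inj₁ (κ v x)
    side v (inj₂ y) = inj₂ (ρ v y)
    side-proper : ∀ u w xu xw → Edge G u w → side u xu ≢ side w xw
    side-proper u w (inj₁ xu) (inj₁ xw) e eq = κ-proper u w xu xw e (inj₁-injective eq)
    side-proper u w (inj₂ yu) (inj₂ yw) e eq = ρ-proper u w yu yw e (inj₂-injective eq)
    side-proper u w (inj₁ _)  (inj₂ _)  e ()
    side-proper u w (inj₂ _)  (inj₁ _)  e ()
    colour : ∀ v → (X Pred.∪ Y) v → Fin (a + b)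
    colour v x = join a b (side v x)
    colour-proper : ∀ u w xu xw → Edge G u w → colour u xu ≢ colour w xw
    colour-proper u w xu xw e eq = side-proper u w xu xw e (begin
      side u xu                        ≡⟨ splitAt-join a b (side u xu) ⟨
      splitAt a (colour u xu)          ≡⟨ cong (splitAt a) eq ⟩
      splitAt a (colour w xw)          ≡⟨ splitAt-join a b (side w xw) ⟩
      side w xw                        ∎)
      where open ≡-Reasoning

  colourable-⋃ : ∀ {m b} {X : Fin m → VSet G} → (∀ i → Colourable G (X i) b) →
                 Colourable G (Pred.⋃ (Fin m) X) (m * b)
  colourable-⋃ {m} {b} {X} X-colourable = colour , colour-proper
    where
    colour : ∀ v → Pred.⋃ (Fin m) X v → Fin (m * b)
    colour v (i , x) = combine i (proj₁ (X-colourable i) v x)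
    colour-proper : ∀ u w xu xw → Edge G u w → colour u xu ≢ colour w xw
    colour-proper u w (i , xu) (j , xw) e eq
      with combine-injective i (proj₁ (X-colourable i) u xu) j (proj₁ (X-colourable j) w xw) eq
    ... | refl , same = proj₂ (X-colourable i) u w xu xw e same

  openNbhd-colourable : ∀ {w s} → Colourable G (ClosedNbhd G w) (suc s) → Colourable G (Edge G w) s
  openNbhd-colourable {w} (κ , κ-proper) = colour , colour-proper
    where
    κw≢κv : ∀ {v} (e : Edge G w v) → κ w (inj₁ refl) ≢ κ v (inj₂ e)
    κw≢κv {v} e = κ-proper w v (inj₁ refl) (inj₂ e) e
    colour : ∀ v → Edge G w v → Fin _
    colour v e = punchOut (κw≢κv e)
    colour-proper : ∀ u v eu ev → Edge G u v → colour u eu ≢ colour v ev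
    colour-proper u v eu ev e eq =
      κ-proper u v (inj₂ eu) (inj₂ ev) e (punchOut-injective (κw≢κv eu) (κw≢κv ev) eq)

  colourable-∪-independent : ∀ {X J : VSet G} {r} → Colourable G X (suc r) → Independent J →
                             (∀ u v → X u → J v → ¬ Edge G u v) → Colourable G (X Pred.∪ J) (suc r)
  colourable-∪-independent {X} {J} {r} (κ , κ-proper) J-indep detached = colour , colour-proper
    where
    colour : ∀ v → (X Pred.∪ J) v → Fin (suc r)
    colour v (inj₁ x) = κ v x
    colour v (inj₂ _) = zero
    colour-proper : ∀ u w xu xw → Edge G u w → colour u xu ≢ colour w xw
    colour-proper u w (inj₁ xu) (inj₁ xw) e = κ-proper u w xu xw e
    colour-proper u w (inj₁ xu) (inj₂ jw) e = λ _ → detached u w xu jw e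
    colour-proper u w (inj₂ ju) (inj₁ xw) e = λ _ → detached w u xw ju (Graph.sym G e)
    colour-proper u w (inj₂ ju) (inj₂ jw) e = λ _ → J-indep u w ju jw e

  colourable-within : ∀ {X : VSet G} {p} (T : Subset p) (κ : ∀ v → X v → Fin p) →
                      (∀ u w xu xw → Edge G u w → κ u xu ≢ κ w xw) → (∀ v x → κ v x ∈ T) →
                      Colourable G X ∣ T ∣
  colourable-within T κ κ-proper κ∈T =
    (λ v x → index T (κ∈T v x)) , λ u w xu xw e eq → κ-proper u w xu xw e (index-injective T _ _ eq)

  colourable-mono : ∀ {X : VSet G} {a b} → a ≤ b → Colourable G X a → Colourable G X b
  colourable-mono a≤b (κ , κ-proper) =
    (λ v x → inject≤ (κ v x) a≤b) ,
    λ u w xu xw e eq → κ-proper u w xu xw e (inject≤-injective a≤b a≤b _ _ eq)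

  closedNbhds-colourable : ∀ {s m} → LocallyColourable G (suc s) → (W : Fin m → V G) →
                           (∀ i j → ¬ Edge G (W i) (W j)) →
                           Colourable G (Pred.⋃ (Fin m) (λ i → ClosedNbhd G (W i))) (1 + m * s)
  closedNbhds-colourable loc W W-independent = colourable-⊆ split (colourable-∪
    (independent-colourable centres-independent) (colourable-⋃ λ i → openNbhd-colourable (loc (W i))))
    where
    Centre : VSet G
    Centre v = ∃ λ i → v ≡ W i
    centres-independent : Independent Centre
    centres-independent _ _ (i , refl) (j , refl) = W-independent i j
    split : Pred.⋃ (Fin _) (λ i → ClosedNbhd G (W i)) Pred.⊆
            Centre Pred.∪ Pred.⋃ (Fin _) (λ i → Edge G (W i))
    split (i , inj₁ v≡Wi) = inj₁ (i , v≡Wi)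
    split (i , inj₂ e)    = inj₂ (i , e)

module _ {n} {P : Pred (Fin n) 0ℓ} (P? : Pred.Decidable P) (f : Fin n → ℕ) where

  maximiser : ∀ {z} → P z → ∃ λ w → P w × ∀ {x} → P x → f x ≤ f w
  maximiser {z} pz =
    w , argmax-all f pz (all-filter P? (allFin n)) ,
    λ px → lookup (f[xs]≤f[argmax] z candidates) (∈-filter⁺ P? (∈-allFin _) px)
    where
    candidates = filter P? (allFin n)
    w = argmax f z candidates

open RawMonad (¬¬-Monad {0ℓ})

¬¬-∀-Fin : ∀ {n} {P : Fin n → Set} → (∀ i → ¬ ¬ P i) → ¬ ¬ (∀ i → P i)
¬¬-∀-Fin {zero}  _   = pure λ ()
¬¬-∀-Fin {suc n} ¬¬P = do
  p₀ ← ¬¬P zero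
  ps ← ¬¬-∀-Fin (λ i → ¬¬P (suc i))
  pure λ { zero → p₀ ; (suc i) → ps i }

Least : (ℕ → Set) → Set
Least P = ∃ λ d → P d × ∀ e → P e → d ≤ e

¬¬-least : (P : ℕ → Set) → ∀ {n} → P n → ¬ ¬ Least P
¬¬-least P {n} = <-rec (λ n → P n → ¬ ¬ Least P) step n
  where
  step : ∀ n → (∀ {m} → m < n → P m → ¬ ¬ Least P) → P n → ¬ ¬ Least P
  step n below pn = ¬¬-excluded-middle {A = ∃ λ m → m < n × P m} >>= λ where
    (yes (m , m<n , pm)) → below m<n pm
    (no ∄m)              → pure (n , pn , λ e pe → ≮⇒≥ λ e<n → ∄m (e , e<n , pe))

module Covering (G : Graph) {p} (σ : V G → Fin p) (σ-proper : Proper G p σ) (σ-onto : Onto G p σ)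
                (edge? : ∀ u v → Dec (Edge G u v)) where

  U : Subset p → VSet G
  U C v = σ v ∈ C

  Sees : Subset p → V G → Fin p → Set
  Sees C z d = d ∈ C × ∃ λ u → ClosedNbhd G z u × σ u ≡ d

  sees? : ∀ C z → Pred.Decidable (Sees C z)
  sees? C z d = d ∈? C ×-dec any? λ u → ((u ≟ z) ⊎-dec edge? z u) ×-dec (σ u ≟ d)

  seen : Subset p → V G → Subset p
  seen C z = satisfying (sees? C z)

  seen⊆ : ∀ {C z} → seen C z ⊆ C
  seen⊆ {C} {z} d∈ = proj₁ (∈-satisfying⁻ (sees? C z) d∈)

  sees-nbr : ∀ {C z u} → U C u → ClosedNbhd G z u → σ u ∈ seen C z
  sees-nbr {C} {z} u∈U u∈N = ∈-satisfying⁺ (sees? C z) (u∈U , _ , u∈N , refl)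

  sees-own : ∀ {C v} → U C v → σ v ∈ seen C v
  sees-own v∈U = sees-nbr v∈U (inj₁ refl)

  sees-nbr⁻ : ∀ {C z d} → d ∈ seen C z → ∃ λ u → ClosedNbhd G z u × σ u ≡ d
  sees-nbr⁻ {C} {z} d∈ = proj₂ (∈-satisfying⁻ (sees? C z) d∈)

  record Cover (C : Subset p) : Set where
    field
      size                : ℕ
      centre              : Fin size → V G
      centre∈U            : ∀ i → U C (centre i)
      centres-independent : ∀ i j → ¬ Edge G (centre i) (centre j)
      covers              : ∀ {d} → d ∈ C → ∃ λ v → σ v ≡ d × ∃ λ i → ClosedNbhd G (centre i) v
      r                   : ℕ
      U-colourable        : Colourable G (U C) (suc r)
      size+r≤∣C∣          : size + r ≤ ∣ C ∣

  empty-cover : ∀ {C} → (∀ {d} → d ∉ C) → Cover C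
  empty-cover C-empty = record
    { size = 0 ; centre = λ () ; centre∈U = λ () ; centres-independent = λ ()
    ; covers = λ d∈C → contradiction d∈C C-empty
    ; r = 0
    ; U-colourable = independent-colourable G λ u _ u∈U _ _ → C-empty u∈U
    ; size+r≤∣C∣ = z≤n }

  module Step {C : Subset p} {w : V G} (w∈U : U C w)
              (w-max : ∀ {z} → U C z → ∣ seen C z ∣ ≤ ∣ seen C w ∣) where

    S : Subset p
    S = seen C w

    -- U C splits into U (C ─ S), the Lonely vertices, which maximality of w keeps away from
    -- U (C ─ S), and the Tinted ones, coloured inside S - σ w: a vertex of colour σ w that misses
    -- some d ∈ S takes the colour d.
    Lonely : VSet G
    Lonely v = σ v ≡ σ w × S ⊆ seen C v

    Tinted : VSet G
    Tinted v = σ v ∈ S - σ w ⊎ (σ v ≡ σ w × ∃ λ d → d ∈ S × d ∉ seen C v)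

    same-colour-as-w : ∀ {v} → σ v ≡ σ w → U C v
    same-colour-as-w σv≡σw = subst (_∈ C) (sym σv≡σw) w∈U

    w-detached : ∀ u → U (C ─ S) u → ¬ Edge G w u
    w-detached u u∈ e = x∈p─q⇒x∉q u∈ (sees-nbr (p─q⊆p C S u∈) (inj₂ e))

    lonely-detached : ∀ u v → U (C ─ S) u → Lonely v → ¬ Edge G u v
    lonely-detached u v u∈ (σv≡σw , S⊆) e = <⇒≱ (p⊂q⇒∣p∣<∣q∣ S⊂) (w-max (same-colour-as-w σv≡σw))
      where
      S⊂ : S ⊂ seen C v
      S⊂ = S⊆ , σ u , sees-nbr (p─q⊆p C S u∈) (inj₂ (Graph.sym G e)) , x∈p─q⇒x∉q u∈

    lonely-independent : Independent G Lonely
    lonely-independent u v (σu≡σw , _) (σv≡σw , _) e = σ-proper u v e (trans σu≡σw (sym σv≡σw))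

    tint : ∀ v → Tinted v → Fin p
    tint v (inj₁ _)           = σ v
    tint v (inj₂ (_ , d , _)) = d

    tint∈S-σw : ∀ v b → tint v b ∈ S - σ w
    tint∈S-σw v (inj₁ σv∈)                       = σv∈
    tint∈S-σw v (inj₂ (σv≡σw , d , d∈S , d∉)) = x∈p∧x≢y⇒x∈p-y d∈S λ d≡σw →
      d∉ (subst (_∈ seen C v) (trans σv≡σw (sym d≡σw)) (sees-own (same-colour-as-w σv≡σw)))

    tint-proper : ∀ u v bu bv → Edge G u v → tint u bu ≢ tint v bv
    tint-proper u v (inj₁ _) (inj₁ _) e = σ-proper u v e
    tint-proper u v (inj₁ σu∈) (inj₂ (_ , _ , _ , d∉)) e σu≡d =
      d∉ (subst (_∈ seen C v) σu≡d (sees-nbr (seen⊆ (p─q⊆p S ⁅ σ w ⁆ σu∈)) (inj₂ (Graph.sym G e))))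
    tint-proper u v (inj₂ (_ , _ , _ , d∉)) (inj₁ σv∈) e d≡σv =
      d∉ (subst (_∈ seen C u) (sym d≡σv) (sees-nbr (seen⊆ (p─q⊆p S ⁅ σ w ⁆ σv∈)) (inj₂ e)))
    tint-proper u v (inj₂ (σu≡σw , _)) (inj₂ (σv≡σw , _)) e _ = σ-proper u v e (trans σu≡σw (sym σv≡σw))

    split : U C Pred.⊆ (U (C ─ S) Pred.∪ Lonely) Pred.∪ Tinted
    split {v} v∈U with σ v ∈? S
    ... | no σv∉S = inj₁ (inj₁ (x∈p∧x∉q⇒x∈p─q v∈U σv∉S))
    ... | yes σv∈S with σ v ≟ σ w
    ...   | no σv≢σw = inj₂ (inj₁ (x∈p∧x≢y⇒x∈p-y σv∈S σv≢σw))
    ...   | yes σv≡σw with any? (λ d → d ∈? S ×-dec ¬? (d ∈? seen C v))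
    ...     | yes missed = inj₂ (inj₂ (σv≡σw , missed))
    ...     | no none    = inj₁ (inj₂ (σv≡σw , λ {d} d∈S →
                             decidable-stable (d ∈? seen C v) λ d∉ → none (d , d∈S , d∉)))

    colouring-step : ∀ {r} → Colourable G (U (C ─ S)) (suc r) →
                     Colourable G (U C) (suc r + ∣ S - σ w ∣)
    colouring-step ρ = colourable-⊆ G split (colourable-∪ G
      (colourable-∪-independent G ρ lonely-independent lonely-detached)
      (colourable-within G (S - σ w) tint tint-proper tint∈S-σw))

    σw∈S : σ w ∈ S
    σw∈S = sees-own w∈U

    extend : Cover (C ─ S) → Cover C
    extend cover = record
      { size = suc size ; centre = w Vector.∷ centre ; centre∈U = centre∈U⁺
      ; centres-independent = centres-independent⁺ ; covers = covers⁺
      ; r = r + ∣ S - σ w ∣ ; U-colourable = colouring-step U-colourable ; size+r≤∣C∣ = bound }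
      where
      open Cover cover
      centre∈U⁺ : ∀ i → U C ((w Vector.∷ centre) i)
      centre∈U⁺ zero    = w∈U
      centre∈U⁺ (suc i) = p─q⊆p C S (centre∈U i)
      centres-independent⁺ : ∀ i j → ¬ Edge G ((w Vector.∷ centre) i) ((w Vector.∷ centre) j)
      centres-independent⁺ zero    zero    = Graph.irr G
      centres-independent⁺ zero    (suc j) = w-detached _ (centre∈U j)
      centres-independent⁺ (suc i) zero    = λ e → w-detached _ (centre∈U i) (Graph.sym G e)
      centres-independent⁺ (suc i) (suc j) = centres-independent i j
      covers⁺ : ∀ {d} → d ∈ C → ∃ λ v → σ v ≡ d × ∃ λ i → ClosedNbhd G ((w Vector.∷ centre) i) v
      covers⁺ {d} d∈C with d ∈? S
      ... | yes d∈S = let u , u∈N , σu≡d = sees-nbr⁻ d∈S in u , σu≡d , zero , u∈N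
      ... | no d∉S  = let v , σv≡d , i , v∈N = covers (x∈p∧x∉q⇒x∈p─q d∈C d∉S)
                      in v , σv≡d , suc i , v∈N
      bound : suc size + (r + ∣ S - σ w ∣) ≤ ∣ C ∣
      bound = begin
        suc size + (r + ∣ S - σ w ∣)  ≡⟨ cong suc (+-assoc size r _) ⟨
        suc (size + r + ∣ S - σ w ∣)  ≡⟨ +-suc (size + r) _ ⟨
        size + r + suc ∣ S - σ w ∣    ≤⟨ +-monoˡ-≤ _ size+r≤∣C∣ ⟩
        ∣ C ─ S ∣ + suc ∣ S - σ w ∣   ≡⟨ cong (∣ C ─ S ∣ +_) (suc∣p-x∣≡∣p∣ σw∈S) ⟩
        ∣ C ─ S ∣ + ∣ S ∣              ≡⟨ ∣p─q∣+∣q∣≡∣p∣ C S seen⊆ ⟩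
        ∣ C ∣                          ∎
        where open ≤-Reasoning

  cover : ∀ C → Cover C
  cover = All.wfRec (On.wellFounded ∣_∣ <-wellFounded) 0ℓ Cover step
    where
    step : ∀ C → (∀ {D} → ∣ D ∣ < ∣ C ∣ → Cover D) → Cover C
    step C smaller with nonempty? C
    ... | no C-empty = empty-cover λ d∈C → C-empty (_ , d∈C)
    ... | yes (d , d∈C) =
      let z , σz≡d        = σ-onto d
          w , w∈U , w-max = maximiser (λ v → σ v ∈? C) (λ v → ∣ seen C v ∣)
                                      (subst (_∈ C) (sym σz≡d) d∈C)
          σw∈C∩S          = x∈p∩q⁺ (w∈U , sees-own w∈U)
      in Step.extend w∈U w-max (smaller (p∩q≢∅⇒∣p─q∣<∣p∣ C (seen C w) (σ w , σw∈C∩S)))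

  allColours-colourable : ∀ {s c k} → LocallyColourable G (suc s) → IsChromatic G c → p ≤ c + k →
                          ∃ λ X → SeesAll G p σ X × Colourable G X (s * (k + 1) + 1)
  allColours-colourable {s} {c} {k} loc χG p≤c+k =
    X , X-sees , colourable-mono G colour-count (closedNbhds-colourable G loc centre centres-independent)
    where
    open Cover (cover (⊤ {p}))
    X : VSet G
    X = Pred.⋃ (Fin size) (λ i → ClosedNbhd G (centre i))
    X-sees : SeesAll G p σ X
    X-sees d = let v , σv≡d , i , v∈N = covers ∈⊤ in v , (i , v∈N) , σv≡d
    size≤1+k : size ≤ suc k
    size≤1+k = +-cancelʳ-≤ c size (suc k) (begin
      size + c        ≤⟨ +-monoʳ-≤ size (proj₂ χG (suc r) (colourable-⊆ G (λ _ → ∈⊤) U-colourable)) ⟩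
      size + suc r    ≡⟨ +-suc size r ⟩
      suc (size + r)  ≤⟨ s≤s size+r≤∣C∣ ⟩
      suc ∣ ⊤ {p} ∣   ≡⟨ cong suc (∣⊤∣≡n p) ⟩
      suc p           ≤⟨ s≤s p≤c+k ⟩
      suc (c + k)     ≡⟨ cong suc (+-comm c k) ⟩
      suc k + c       ∎)
      where open ≤-Reasoning
    colour-count : 1 + size * s ≤ s * (k + 1) + 1
    colour-count = begin
      1 + size * s     ≡⟨ +-comm 1 (size * s) ⟩
      size * s + 1     ≤⟨ +-monoˡ-≤ 1 (*-monoˡ-≤ s size≤1+k) ⟩
      suc k * s + 1    ≡⟨ cong (_+ 1) (*-comm (suc k) s) ⟩
      s * suc k + 1    ≡⟨ cong (λ t → s * t + 1) (+-comm 1 k) ⟩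
      s * (k + 1) + 1  ∎
      where open ≤-Reasoning

-- Deciding the edges and taking χ(G[X]) are the classical steps; both are harmless under ¬ ¬
-- because the goal f ≤ … is decidable.
f-bound : ∀ s k (G : Graph) → LocallyColourable G (suc s) →
          ∀ c f → IsChromatic G c → IsF G (c + k) f → f ≤ s * (k + 1) + 1
f-bound s k G loc c f χG ((σ , (σ-proper , σ-onto) , _ , f-minimal) , _) =
  decidable-stable (f ≤? _) do
  edge? ← ¬¬-∀-Fin λ u → ¬¬-∀-Fin λ v → ¬¬-excluded-middle
  let X , X-sees , X-colourable =
        Covering.allColours-colourable G σ σ-proper σ-onto edge? loc χG ≤-refl
  d , χX ← ¬¬-least (Colourable G X) X-colourable
  pure (≤-trans (f-minimal X d X-sees χX) (proj₂ χX _ X-colourable))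

theorem3p2 : ∀ (s k : ℕ) → 2 ≤ s → ∀ (G : Graph) → LocallyColourable G s →
    ∀ (c f : ℕ) → IsChromatic G c → c + k ≤ n G → IsF G (c + k) f →
      f ≤ (s ∸ 1) * (k + 1) + 1
theorem3p2 zero    k ()
theorem3p2 (suc s) k _ G loc c f χG _ isF = f-bound s k G loc c f χG isF
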